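{- Let $G$ be a finite invertible bicoloured graph. Then $\mathrm{Aut}(G^{ -1})=\mathrm{Aut}(G)$ (equality of groups of permutations of $V(G)$).
   Context: A bicoloured graph is a simple graph whose vertices are coloured black or white; an uncoloured graph is given its natural colouring (even degree white, odd degree black). For bicoloured $G$ and $u\in V(G)$, $Gu$ has edge set $E(G)\triangle\{[x,y]:x\ne y\in N_G(u)\}$ and the same colouring if $u$ is black, while if $u$ is white the colours of all vertices of $N_G(u)$ are reversed; for a word $s=u_1\cdots u_k$, $Gs=(\cdots(Gu_1)\cdots)u_k$. $W^\circ(G)$ (parity words) is the smallest set of words containing the empty word such that $s\in W^\circ(G)$, $u$ white in $Gs$ implies $su\in W^\circ(G)$, and $s\in W^\circ(G)$, $u,v$ adjacent black in $Gs$ implies $suvu,svuv\in W^\circ(G)$. A word $s$ is reduced (w.r.t. $G$) if $s=s_1\cdots s_n$ where the letter sets of the blocks $s_i$ are pairwise disjoint and each $s_i$ is either a single vertex or a word $uvu$ with $[u,v]\in E(Gs_1\cdots s_{i-1})$. $S\subseteq V(G)$ is a complementation set if some reduced parity word $s$ has letter set $S$; then $GS:=Gs$ (this does not depend on the choice of $s$). $G$ is invertible if $V(G)$ is a complementation set, and then $G^{ -1}:=GV(G)$. $\mathrm{Aut}$ of a bicoloured graph consists of the adjacency- and colour-preserving permutations of the vertex set. -}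

module Defs where

open import Data.Nat using (ℕ)
open import Data.Bool using (Bool; true; false; _xor_; _∧_; not; if_then_else_)
open import Data.Fin using (Fin; _≟_)
open import Data.Fin.Permutation using (Permutation′; _⟨$⟩ʳ_)
open import Data.List using (List; []; _∷_; _++_; [_]; foldl)
open import Data.List.Membership.Propositional using (_∈_; _∉_)
open import Relation.Nullary using (¬_; Dec; yes; no)
open import Relation.Nullary.Decidable using (⌊_⌋)
open import Relation.Binary.PropositionalEquality using (_≡_)
open import Data.Product using (∃; _×_)

-- Colour convention: true = black, false = white.
Colour : Set
Colour = Bool

black white : Colour
black = true
white = false

record BGraph (n : ℕ) : Set where
  constructor mkBGraph
  field
    adj : Fin n → Fin n → Bool
    col : Fin n → Colour
open BGraph public

record IsSimple {n : ℕ} (G : BGraph n) : Set where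
  field
    adj-sym     : ∀ x y → adj G x y ≡ adj G y x
    adj-irrefl  : ∀ x → adj G x x ≡ false
open IsSimple public

_≠ᵇ_ : ∀ {n} → Fin n → Fin n → Bool
x ≠ᵇ y = not ⌊ x ≟ y ⌋

_·_ : ∀ {n} → BGraph n → Fin n → BGraph n
adj (G · u) x y = adj G x y xor ((x ≠ᵇ y) ∧ (adj G u x ∧ adj G u y))
col (G · u) x with col G u
... | true  = col G x
... | false = col G x xor adj G u x

_⋆_ : ∀ {n} → BGraph n → List (Fin n) → BGraph n
G ⋆ s = foldl _·_ G s

data Parity {n : ℕ} (G : BGraph n) : List (Fin n) → Set where
  p-nil   : Parity G []
  p-white : ∀ {s u} → Parity G s → col (G ⋆ s) u ≡ white → Parity G (s ++ [ u ])
  p-uvu   : ∀ {s u v} → Parity G s → adj (G ⋆ s) u v ≡ true →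
            col (G ⋆ s) u ≡ black → col (G ⋆ s) v ≡ black →
            Parity G (s ++ (u ∷ v ∷ u ∷ []))
  p-vuv   : ∀ {s u v} → Parity G s → adj (G ⋆ s) u v ≡ true →
            col (G ⋆ s) u ≡ black → col (G ⋆ s) v ≡ black →
            Parity G (s ++ (v ∷ u ∷ v ∷ []))

-- Reduced words: s = s₁⋯sₘ, blocks with pairwise disjoint letter sets, each block
-- a single vertex or uvu with [u,v] an edge of G s₁⋯s_{i-1}.
-- (Built block by block; a new block's letters must avoid all letters of the
-- earlier blocks, which is exactly pairwise disjointness.)
data Reduced {n : ℕ} (G : BGraph n) : List (Fin n) → Set where
  r-nil    : Reduced G []
  r-single : ∀ {s u} → Reduced G s → u ∉ s → Reduced G (s ++ [ u ])
  r-triple : ∀ {s u v} → Reduced G s → u ∉ s → v ∉ s →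
             adj (G ⋆ s) u v ≡ true → Reduced G (s ++ (u ∷ v ∷ u ∷ []))

CoversAll : ∀ {n} → List (Fin n) → Set
CoversAll {n} s = ∀ (x : Fin n) → x ∈ s

Invertible : ∀ {n} → BGraph n → Set
Invertible {n} G = ∃ λ s → Parity G s × Reduced G s × CoversAll s

IsAut : ∀ {n} → BGraph n → Permutation′ n → Set
IsAut {n} G σ = (∀ x y → adj G (σ ⟨$⟩ʳ x) (σ ⟨$⟩ʳ y) ≡ adj G x y)
              × (∀ x → col G (σ ⟨$⟩ʳ x) ≡ col G x)

-- Over GF(2) encode a bicoloured graph K by the symmetric matrix M_K: its adjacency matrix with a 1
-- on the diagonal at each white vertex.  Complementing at a white vertex u replaces M_K by its
-- principal pivot transform on {u}, and complementing at u, v, u for an edge uv of black vertices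
-- replaces it by the pivot on {u, v}.  Pivots on disjoint index sets compose, so a reduced parity
-- word with letter set V(G) turns M_G into its pivot on all of V(G), which is the inverse matrix.
-- Finally, σ is an automorphism of K exactly when it commutes with M_K, and a permutation that
-- commutes with a matrix commutes with its inverse.

module Submission where

open import Defs
open import Algebra.Bundles using (CommutativeRing)
open import Data.Bool using (Bool; true; false; T; not; _∧_; _∨_; _xor_; if_then_else_)
import Data.Bool.Properties as Bool
open import Data.Empty using (⊥-elim)
open import Data.Fin using (Fin; zero; suc; _≟_)
open import Data.Fin.Properties using (suc-injective)
open import Data.Fin.Permutation using (Permutation′; _⟨$⟩ʳ_; _⟨$⟩ˡ_; inverseˡ)
open import Data.List using (List; []; _∷_; _++_; [_])
open import Data.List.Properties using (∷ʳ-injective; ++-assoc; foldl-++)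
open import Data.List.Membership.Propositional using (_∈_; _∉_)
open import Data.List.Membership.Propositional.Properties using (∈-++⁺ʳ; ∈-++⁻)
open import Data.List.Relation.Unary.Any using (here; there)
open import Data.Nat using (ℕ; zero; suc)
open import Data.Product using (_×_; _,_; proj₁; proj₂; swap)
open import Data.Sum using (_⊎_; inj₁; inj₂)
open import Data.Unit using (tt)
open import Data.Vec.Functional using (Vector)
open import Function using (_∘_)
open import Function.Bundles using (_⇔_; mk⇔; Equivalence)
open import Function.Construct.Composition using (_⇔-∘_)
open import Function.Construct.Symmetry using (⇔-sym)
open import Relation.Binary.PropositionalEquality using (_≡_; refl; sym; trans; cong; cong₂; subst; _≗_; module ≡-Reasoning)
open import Relation.Nullary using (¬_; yes; no)
open import Relation.Nullary.Decidable using (⌊_⌋; ⌊⌋-map′; toWitness)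
open import Algebra.Properties.Semiring.Sum (CommutativeRing.semiring Bool.xor-∧-commutativeRing)
  using (sum; sum-cong-≗; sum-replicate-zero; ∑-distrib-+; *-distribˡ-sum; sum-permute)

BoolFun : ℕ → Set
BoolFun zero    = Bool
BoolFun (suc k) = Bool → BoolFun k

agree : ∀ k → BoolFun k → BoolFun k → Bool
agree zero    a b = ⌊ a Bool.≟ b ⌋
agree (suc k) f g = agree k (f true) (g true) ∧ agree k (f false) (g false)

Agree : ∀ k → BoolFun k → BoolFun k → Set
Agree zero    a b = a ≡ b
Agree (suc k) f g = ∀ x → Agree k (f x) (g x)

truthTable : ∀ k (f g : BoolFun k) → T (agree k f g) → Agree k f g
truthTable zero    a b ok       = toWitness ok
truthTable (suc k) f g ok true  = truthTable k (f true) (g true) (proj₁ (Equivalence.to Bool.T-∧ ok))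
truthTable (suc k) f g ok false = truthTable k (f false) (g false) (proj₂ (Equivalence.to Bool.T-∧ ok))

-- Vectors and matrices over GF(2)

δ : ∀ {n} → Fin n → Fin n → Bool
δ i j = ⌊ i ≟ j ⌋

δ-refl : ∀ {n} (i : Fin n) → δ i i ≡ true
δ-refl i with i ≟ i
... | yes _   = refl
... | no i≢i = ⊥-elim (i≢i refl)

δ-≢ : ∀ {n} {i j : Fin n} → ¬ i ≡ j → δ i j ≡ false
δ-≢ {i = i} {j} i≢j with i ≟ j
... | yes i≡j = ⊥-elim (i≢j i≡j)
... | no _    = refl

δ-suc : ∀ {n} (i j : Fin n) → δ (suc i) (suc j) ≡ δ i j
δ-suc i j = ⌊⌋-map′ (cong suc) suc-injective (i ≟ j)

δ-sym : ∀ {n} (i j : Fin n) → δ i j ≡ δ j i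
δ-sym i j with i ≟ j | j ≟ i
... | yes _   | yes _   = refl
... | no _    | no _    = refl
... | yes i≡j | no j≢i = ⊥-elim (j≢i (sym i≡j))
... | no i≢j  | yes j≡i = ⊥-elim (i≢j (sym j≡i))

δ-view : ∀ {n} (i j : Fin n) → i ≡ j ⊎ δ i j ≡ false
δ-view i j with i ≟ j
... | yes i≡j = inj₁ i≡j
... | no i≢j  = inj₂ refl

δ-∧-δ : ∀ {n} (u : Fin n) {i j} → δ i j ≡ false → δ u i ∧ δ u j ≡ false
δ-∧-δ u {i} {j} δij with δ-view u i
... | inj₁ refl = trans (cong (δ u u ∧_) δij) (Bool.∧-zeroʳ (δ u u))
... | inj₂ δui  = cong (_∧ δ u j) δui

dot : ∀ {n} → Vector Bool n → Vector Bool n → Bool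
dot a x = sum (λ j → a j ∧ x j)

dot-congʳ : ∀ {n} (a : Vector Bool n) {x y : Vector Bool n} → x ≗ y → dot a x ≡ dot a y
dot-congʳ a x≗y = sum-cong-≗ (λ j → cong (a j ∧_) (x≗y j))

dot-congˡ : ∀ {n} {a b : Vector Bool n} (x : Vector Bool n) → a ≗ b → dot a x ≡ dot b x
dot-congˡ x a≗b = sum-cong-≗ (λ j → cong (_∧ x j) (a≗b j))

dot-δ : ∀ {n} (a : Vector Bool n) (u : Fin n) → dot a (δ u) ≡ a u
dot-δ {suc n} a zero = trans
  (cong₂ _xor_ (Bool.∧-identityʳ (a zero))
               (trans (sum-cong-≗ (λ j → Bool.∧-zeroʳ (a (suc j)))) (sum-replicate-zero n)))
  (Bool.xor-identityʳ (a zero))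
dot-δ {suc n} a (suc u) = cong₂ _xor_ (Bool.∧-zeroʳ (a zero))
  (trans (sum-cong-≗ (λ j → cong (a (suc j) ∧_) (δ-suc u j))) (dot-δ (a ∘ suc) u))

dot-bumpʳ : ∀ {n} (r x : Vector Bool n) c u →
  dot r (λ j → x j xor (c ∧ δ u j)) ≡ dot r x xor (c ∧ r u)
dot-bumpʳ r x c u = begin
  sum (λ j → r j ∧ (x j xor (c ∧ δ u j)))         ≡⟨ sum-cong-≗ (λ j → distrib (r j) (x j) (δ u j)) ⟩
  sum (λ j → (r j ∧ x j) xor (c ∧ (r j ∧ δ u j))) ≡⟨ ∑-distrib-+ (λ j → r j ∧ x j) (λ j → c ∧ (r j ∧ δ u j)) ⟩
  dot r x xor sum (λ j → c ∧ (r j ∧ δ u j))       ≡⟨ cong (dot r x xor_) (sym (*-distribˡ-sum c (λ j → r j ∧ δ u j))) ⟩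
  dot r x xor (c ∧ dot r (δ u))                   ≡⟨ cong (λ z → dot r x xor (c ∧ z)) (dot-δ r u) ⟩
  dot r x xor (c ∧ r u)                           ∎
  where
  open ≡-Reasoning
  distrib : ∀ a b e → a ∧ (b xor (c ∧ e)) ≡ (a ∧ b) xor (c ∧ (a ∧ e))
  distrib a b e = truthTable 4 (λ a b c e → a ∧ (b xor (c ∧ e))) (λ a b c e → (a ∧ b) xor (c ∧ (a ∧ e))) tt a b c e

dot-bumpˡ : ∀ {n} (a x : Vector Bool n) u → dot (λ j → a j xor δ u j) x ≡ dot a x xor x u
dot-bumpˡ a x u = begin
  sum (λ j → (a j xor δ u j) ∧ x j)      ≡⟨ sum-cong-≗ (λ j → Bool.∧-distribʳ-xor (x j) (a j) (δ u j)) ⟩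
  sum (λ j → (a j ∧ x j) xor (δ u j ∧ x j)) ≡⟨ ∑-distrib-+ (λ j → a j ∧ x j) (λ j → δ u j ∧ x j) ⟩
  dot a x xor sum (λ j → δ u j ∧ x j)     ≡⟨ cong (dot a x xor_) (sum-cong-≗ (λ j → Bool.∧-comm (δ u j) (x j))) ⟩
  dot a x xor dot x (δ u)                 ≡⟨ cong (dot a x xor_) (dot-δ x u) ⟩
  dot a x xor x u                         ∎
  where open ≡-Reasoning

Matrix : ℕ → Set
Matrix n = Fin n → Fin n → Bool

_*ᵥ_ : ∀ {n} → Matrix n → Vector Bool n → Vector Bool n
(M *ᵥ x) i = dot (M i) x

Symmetric : ∀ {n} → Matrix n → Set
Symmetric M = ∀ i j → M i j ≡ M j i

*ᵥ-outer : ∀ {n} {M M′ : Matrix n} (a b : Vector Bool n) → (∀ i j → M′ i j ≡ M i j xor (a i ∧ b j)) →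
  ∀ x i → (M′ *ᵥ x) i ≡ (M *ᵥ x) i xor (a i ∧ dot b x)
*ᵥ-outer {M = M} {M′} a b M′≡ x i = begin
  sum (λ j → M′ i j ∧ x j)                          ≡⟨ sum-cong-≗ (λ j → cong (_∧ x j) (M′≡ i j)) ⟩
  sum (λ j → (M i j xor (a i ∧ b j)) ∧ x j)         ≡⟨ sum-cong-≗ (λ j → distrib (M i j) (b j) (x j)) ⟩
  sum (λ j → (M i j ∧ x j) xor (a i ∧ (b j ∧ x j))) ≡⟨ ∑-distrib-+ (λ j → M i j ∧ x j) (λ j → a i ∧ (b j ∧ x j)) ⟩
  (M *ᵥ x) i xor sum (λ j → a i ∧ (b j ∧ x j))      ≡⟨ cong ((M *ᵥ x) i xor_) (sym (*-distribˡ-sum (a i) (λ j → b j ∧ x j))) ⟩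
  (M *ᵥ x) i xor (a i ∧ dot b x)                    ∎
  where
  open ≡-Reasoning
  distrib : ∀ m q z → (m xor (a i ∧ q)) ∧ z ≡ (m ∧ z) xor (a i ∧ (q ∧ z))
  distrib m q z = truthTable 4 (λ m p q z → (m xor (p ∧ q)) ∧ z) (λ m p q z → (m ∧ z) xor (p ∧ (q ∧ z))) tt m (a i) q z

-- Principal pivot transforms

_∪_ : ∀ {n} → Vector Bool n → Vector Bool n → Vector Bool n
(S ∪ R) i = S i ∨ R i

Disjoint : ∀ {n} → Vector Bool n → Vector Bool n → Set
Disjoint S R = ∀ i → S i ∧ R i ≡ false

override : ∀ {n} → Vector Bool n → Vector Bool n → Vector Bool n → Vector Bool n
override S x y i = if S i then y i else x i

override-cong : ∀ {n} {S R : Vector Bool n} → S ≗ R → ∀ x y → override S x y ≗ override R x y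
override-cong S≗R x y i = cong (λ b → if b then y i else x i) (S≗R i)

override-δ : ∀ {n} (u : Fin n) (x y : Vector Bool n) j →
  override (δ u) x y j ≡ x j xor ((x u xor y u) ∧ δ u j)
override-δ u x y j with δ-view u j
... | inj₁ refl rewrite δ-refl u = truthTable 2 (λ a b → b) (λ a b → a xor ((a xor b) ∧ true)) tt (x u) (y u)
... | inj₂ δuj  rewrite δuj      = truthTable 2 (λ a c → a) (λ a c → a xor (c ∧ false)) tt (x j) (x u xor y u)

override-δ∪δ : ∀ {n} {u v : Fin n} → ¬ u ≡ v → (x y : Vector Bool n) → ∀ j →
  override (δ u ∪ δ v) x y j ≡ (x j xor ((x u xor y u) ∧ δ u j)) xor ((x v xor y v) ∧ δ v j)
override-δ∪δ {u = u} {v} u≢v x y j with δ-view u j | δ-view v j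
... | inj₁ refl | inj₁ refl = ⊥-elim (u≢v refl)
... | inj₁ refl | inj₂ δvj rewrite δ-refl u | δvj =
  truthTable 3 (λ a b d → b) (λ a b d → (a xor ((a xor b) ∧ true)) xor (d ∧ false)) tt (x u) (y u) (x v xor y v)
... | inj₂ δuj | inj₁ refl rewrite δ-refl v | δuj =
  truthTable 3 (λ a b c → b) (λ a b c → (a xor (c ∧ false)) xor ((a xor b) ∧ true)) tt (x v) (y v) (x u xor y u)
... | inj₂ δuj | inj₂ δvj rewrite δuj | δvj =
  truthTable 3 (λ a c d → a) (λ a c d → (a xor (c ∧ false)) xor (d ∧ false)) tt (x j) (x u xor y u) (x v xor y v)

dot-override-δ : ∀ {n} (r : Vector Bool n) u (x y : Vector Bool n) →
  dot r (override (δ u) x y) ≡ dot r x xor ((x u xor y u) ∧ r u)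
dot-override-δ r u x y = trans (dot-congʳ r (override-δ u x y)) (dot-bumpʳ r x (x u xor y u) u)

dot-override-δ∪δ : ∀ {n} (r : Vector Bool n) {u v} → ¬ u ≡ v → (x y : Vector Bool n) →
  dot r (override (δ u ∪ δ v) x y) ≡ (dot r x xor ((x u xor y u) ∧ r u)) xor ((x v xor y v) ∧ r v)
dot-override-δ∪δ r {u} {v} u≢v x y = begin
  dot r (override (δ u ∪ δ v) x y)                               ≡⟨ dot-congʳ r (override-δ∪δ u≢v x y) ⟩
  dot r (λ j → (x j xor (cu ∧ δ u j)) xor (cv ∧ δ v j))          ≡⟨ dot-bumpʳ r (λ j → x j xor (cu ∧ δ u j)) cv v ⟩
  dot r (λ j → x j xor (cu ∧ δ u j)) xor (cv ∧ r v)              ≡⟨ cong (_xor (cv ∧ r v)) (dot-bumpʳ r x cu u) ⟩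
  (dot r x xor (cu ∧ r u)) xor (cv ∧ r v)                        ∎
  where
  open ≡-Reasoning
  cu = x u xor y u
  cv = x v xor y v

-- B is the principal pivot transform of A on S: exchanging the S-coordinates of x and A x
-- carries the graph of A onto the graph of B.
PivotsTo : ∀ {n} → Vector Bool n → Matrix n → Matrix n → Set
PivotsTo S A B = ∀ x → B *ᵥ override S x (A *ᵥ x) ≗ override S (A *ᵥ x) x

IsPivot : ∀ {n} → Vector Bool n → Matrix n → Matrix n → Set
IsPivot S A B = PivotsTo S A B × PivotsTo S B A

pivotsTo-cong : ∀ {n} {S R : Vector Bool n} {A B} → S ≗ R → PivotsTo S A B → PivotsTo R A B
pivotsTo-cong {S = S} {R} {A} {B} S≗R AB x i = begin
  (B *ᵥ override R x (A *ᵥ x)) i ≡⟨ dot-congʳ (B i) (λ j → sym (override-cong S≗R x (A *ᵥ x) j)) ⟩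
  (B *ᵥ override S x (A *ᵥ x)) i ≡⟨ AB x i ⟩
  override S (A *ᵥ x) x i        ≡⟨ override-cong S≗R (A *ᵥ x) x i ⟩
  override R (A *ᵥ x) x i        ∎
  where open ≡-Reasoning

pivotsTo-∪ : ∀ {n} {S R : Vector Bool n} {A B C} → Disjoint S R →
  PivotsTo S A B → PivotsTo R B C → PivotsTo (S ∪ R) A C
pivotsTo-∪ {S = S} {R} {A} {B} {C} S∩R AB BC x i = begin
  (C *ᵥ override (S ∪ R) x Ax) i ≡⟨ dot-congʳ (C i) (λ j → trans (split (S j) (R j) (S∩R j)) (cong (λ z → if R j then z else y j) (sym (AB x j)))) ⟩
  (C *ᵥ override R y (B *ᵥ y)) i ≡⟨ BC y i ⟩
  override R (B *ᵥ y) y i       ≡⟨ cong (λ z → if R i then y i else z) (AB x i) ⟩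
  (if R i then y i else (if S i then x i else Ax i)) ≡⟨ sym (split (S i) (R i) (S∩R i)) ⟩
  override (S ∪ R) Ax x i       ∎
  where
  open ≡-Reasoning
  Ax = A *ᵥ x
  y = override S x Ax
  split : ∀ s r {a b : Bool} → s ∧ r ≡ false →
    (if s ∨ r then b else a) ≡ (if r then (if s then a else b) else (if s then b else a))
  split true  true  ()
  split true  false _ = refl
  split false true  _ = refl
  split false false _ = refl

pivot-cong : ∀ {n} {S R : Vector Bool n} {A B} → S ≗ R → IsPivot S A B → IsPivot R A B
pivot-cong S≗R (AB , BA) = pivotsTo-cong S≗R AB , pivotsTo-cong S≗R BA

pivot-∪ : ∀ {n} {S R : Vector Bool n} {A B C} → Disjoint S R →
  IsPivot S A B → IsPivot R B C → IsPivot (S ∪ R) A C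
pivot-∪ {S = S} {R} S∩R (AB , BA) (BC , CB) =
  pivotsTo-∪ S∩R AB BC ,
  pivotsTo-cong (λ i → Bool.∨-comm (R i) (S i)) (pivotsTo-∪ (λ i → trans (Bool.∧-comm (R i) (S i)) (S∩R i)) CB BA)

rankOne-pivotsTo : ∀ {n} {M M′ : Matrix n} (u : Fin n) (a : Vector Bool n) → Symmetric M →
  (∀ j → M u j ≡ a j xor δ u j) → a u ≡ false →
  (∀ i j → M′ i j ≡ M i j xor (a i ∧ a j)) → PivotsTo (δ u) M M′
rankOne-pivotsTo {M = M} {M′} u a M-sym rowᵤ aᵤ M′≡ x i = begin
  (M′ *ᵥ x′) i                                         ≡⟨ *ᵥ-outer {M = M} a a M′≡ x′ i ⟩
  (M *ᵥ x′) i xor (a i ∧ dot a x′)                     ≡⟨ cong₂ (λ p q → p xor (a i ∧ q)) (dot-override-δ (M i) u x y) (dot-override-δ a u x y) ⟩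
  (y i xor (c ∧ M i u)) xor (a i ∧ (D xor (c ∧ a u)))  ≡⟨ collect (y i) (y u) (x u) D (a i) (M i u) (a u) (δ u i) yᵤ (trans (M-sym i u) (rowᵤ i)) aᵤ ⟩
  y i xor ((y u xor x u) ∧ δ u i)                      ≡⟨ sym (override-δ u y x i) ⟩
  override (δ u) y x i                                 ∎
  where
  open ≡-Reasoning
  y = M *ᵥ x
  x′ = override (δ u) x y
  c = x u xor y u
  D = dot a x
  yᵤ : y u ≡ D xor x u
  yᵤ = trans (dot-congˡ x rowᵤ) (dot-bumpˡ a x u)
  collect : ∀ yi yu xu d ai miu au ei → yu ≡ d xor xu → miu ≡ ai xor ei → au ≡ false →
    (yi xor ((xu xor yu) ∧ miu)) xor (ai ∧ (d xor ((xu xor yu) ∧ au))) ≡ yi xor ((yu xor xu) ∧ ei)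
  collect yi _ xu d ai _ _ ei refl refl refl = truthTable 5
    (λ yi xu d ai ei → (yi xor ((xu xor (d xor xu)) ∧ (ai xor ei))) xor (ai ∧ (d xor ((xu xor (d xor xu)) ∧ false))))
    (λ yi xu d ai ei → yi xor (((d xor xu) xor xu) ∧ ei)) tt yi xu d ai ei

rankOne-pivot : ∀ {n} {M M′ : Matrix n} (u : Fin n) (a : Vector Bool n) → Symmetric M →
  (∀ j → M u j ≡ a j xor δ u j) → a u ≡ false →
  (∀ i j → M′ i j ≡ M i j xor (a i ∧ a j)) → IsPivot (δ u) M M′
rankOne-pivot {M = M} {M′} u a M-sym rowᵤ aᵤ M′≡ =
  rankOne-pivotsTo u a M-sym rowᵤ aᵤ M′≡ , rankOne-pivotsTo u a M′-sym rowᵤ′ aᵤ M≡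
  where
  M′-sym : Symmetric M′
  M′-sym i j = trans (M′≡ i j) (trans (cong₂ _xor_ (M-sym i j) (Bool.∧-comm (a i) (a j))) (sym (M′≡ j i)))
  rowᵤ′ : ∀ j → M′ u j ≡ a j xor δ u j
  rowᵤ′ j = trans (M′≡ u j) (trans (cong (λ b → M u j xor (b ∧ a j)) aᵤ) (trans (Bool.xor-identityʳ (M u j)) (rowᵤ j)))
  M≡ : ∀ i j → M i j ≡ M′ i j xor (a i ∧ a j)
  M≡ i j = trans (truthTable 2 (λ m p → m) (λ m p → (m xor p) xor p) tt (M i j) (a i ∧ a j))
                 (cong (_xor (a i ∧ a j)) (sym (M′≡ i j)))

rankTwo-pivotsTo : ∀ {n} {M M′ : Matrix n} {u v : Fin n} (P Q : Vector Bool n) → Symmetric M → ¬ u ≡ v →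
  (∀ j → M u j ≡ P j xor δ u j) → (∀ j → M v j ≡ Q j xor δ v j) →
  P u ≡ true → P v ≡ true → Q u ≡ true → Q v ≡ true →
  (∀ i j → M′ i j ≡ (M i j xor (P i ∧ Q j)) xor (Q i ∧ P j)) → PivotsTo (δ u ∪ δ v) M M′
rankTwo-pivotsTo {M = M} {M′} {u} {v} P Q M-sym u≢v rowᵤ rowᵥ Pᵤ Pᵥ Qᵤ Qᵥ M′≡ x i = begin
  (M′ *ᵥ x′) i
    ≡⟨ *ᵥ-outer {M = N} Q P M′≡ x′ i ⟩
  (N *ᵥ x′) i xor (Q i ∧ dot P x′)
    ≡⟨ cong (_xor (Q i ∧ dot P x′)) (*ᵥ-outer {M = M} P Q (λ _ _ → refl) x′ i) ⟩
  ((M *ᵥ x′) i xor (P i ∧ dot Q x′)) xor (Q i ∧ dot P x′)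
    ≡⟨ cong₂ (λ m q → (m xor (P i ∧ q)) xor (Q i ∧ dot P x′)) (dot-override-δ∪δ (M i) u≢v x y) (dot-override-δ∪δ Q u≢v x y) ⟩
  (Mx′ᵢ xor (P i ∧ Qx′)) xor (Q i ∧ dot P x′)
    ≡⟨ cong (λ p → (Mx′ᵢ xor (P i ∧ Qx′)) xor (Q i ∧ p)) (dot-override-δ∪δ P u≢v x y) ⟩
  (Mx′ᵢ xor (P i ∧ Qx′)) xor (Q i ∧ Px′)
    ≡⟨ collect (y i) (y u) (y v) (x u) (x v) (dot P x) (dot Q x) (P i) (Q i) (M i u) (M i v)
               (P u) (P v) (Q u) (Q v) (δ u i) (δ v i)
               (trans (dot-congˡ x rowᵤ) (dot-bumpˡ P x u)) (trans (dot-congˡ x rowᵥ) (dot-bumpˡ Q x v))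
               (trans (M-sym i u) (rowᵤ i)) (trans (M-sym i v) (rowᵥ i)) Pᵤ Pᵥ Qᵤ Qᵥ ⟩
  (y i xor ((y u xor x u) ∧ δ u i)) xor ((y v xor x v) ∧ δ v i)
    ≡⟨ sym (override-δ∪δ u≢v y x i) ⟩
  override (δ u ∪ δ v) y x i
    ∎
  where
  open ≡-Reasoning
  N : Matrix _
  N i j = M i j xor (P i ∧ Q j)
  y = M *ᵥ x
  x′ = override (δ u ∪ δ v) x y
  cᵤ = x u xor y u
  cᵥ = x v xor y v
  Mx′ᵢ = (y i xor (cᵤ ∧ M i u)) xor (cᵥ ∧ M i v)
  Qx′ = (dot Q x xor (cᵤ ∧ Q u)) xor (cᵥ ∧ Q v)
  Px′ = (dot P x xor (cᵤ ∧ P u)) xor (cᵥ ∧ P v)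
  collect : ∀ yi yu yv xu xv dP dQ pi qi miu miv pu pv qu qv eui evi →
    yu ≡ dP xor xu → yv ≡ dQ xor xv → miu ≡ pi xor eui → miv ≡ qi xor evi →
    pu ≡ true → pv ≡ true → qu ≡ true → qv ≡ true →
    (((yi xor ((xu xor yu) ∧ miu)) xor ((xv xor yv) ∧ miv)) xor (pi ∧ ((dQ xor ((xu xor yu) ∧ qu)) xor ((xv xor yv) ∧ qv))))
      xor (qi ∧ ((dP xor ((xu xor yu) ∧ pu)) xor ((xv xor yv) ∧ pv)))
    ≡ (yi xor ((yu xor xu) ∧ eui)) xor ((yv xor xv) ∧ evi)
  collect yi _ _ xu xv dP dQ pi qi _ _ _ _ _ _ eui evi refl refl refl refl refl refl refl refl =
    truthTable 9
      (λ yi xu xv dP dQ pi qi eui evi →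
        (((yi xor ((xu xor (dP xor xu)) ∧ (pi xor eui))) xor ((xv xor (dQ xor xv)) ∧ (qi xor evi)))
          xor (pi ∧ ((dQ xor ((xu xor (dP xor xu)) ∧ true)) xor ((xv xor (dQ xor xv)) ∧ true))))
        xor (qi ∧ ((dP xor ((xu xor (dP xor xu)) ∧ true)) xor ((xv xor (dQ xor xv)) ∧ true))))
      (λ yi xu xv dP dQ pi qi eui evi → (yi xor (((dP xor xu) xor xu) ∧ eui)) xor (((dQ xor xv) xor xv) ∧ evi))
      tt yi xu xv dP dQ pi qi eui evi

rankTwo-pivot : ∀ {n} {M M′ : Matrix n} {u v : Fin n} (P Q : Vector Bool n) → Symmetric M → ¬ u ≡ v →
  (∀ j → M u j ≡ P j xor δ u j) → (∀ j → M v j ≡ Q j xor δ v j) →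
  P u ≡ true → P v ≡ true → Q u ≡ true → Q v ≡ true →
  (∀ i j → M′ i j ≡ (M i j xor (P i ∧ Q j)) xor (Q i ∧ P j)) → IsPivot (δ u ∪ δ v) M M′
rankTwo-pivot {M = M} {M′} {u} {v} P Q M-sym u≢v rowᵤ rowᵥ Pᵤ Pᵥ Qᵤ Qᵥ M′≡ =
  rankTwo-pivotsTo P Q M-sym u≢v rowᵤ rowᵥ Pᵤ Pᵥ Qᵤ Qᵥ M′≡ ,
  rankTwo-pivotsTo Q P M′-sym u≢v rowᵤ′ rowᵥ′ Qᵤ Qᵥ Pᵤ Pᵥ M≡
  where
  M′-sym : Symmetric M′
  M′-sym i j rewrite M′≡ i j | M′≡ j i | M-sym i j =
    truthTable 5 (λ m a b c d → (m xor (a ∧ b)) xor (c ∧ d)) (λ m a b c d → (m xor (d ∧ c)) xor (b ∧ a)) tt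
      (M j i) (P i) (Q j) (Q i) (P j)
  rowᵤ′ : ∀ j → M′ u j ≡ Q j xor δ u j
  rowᵤ′ j rewrite M′≡ u j | rowᵤ j | Pᵤ | Qᵤ =
    truthTable 3 (λ p e q → ((p xor e) xor q) xor p) (λ p e q → q xor e) tt (P j) (δ u j) (Q j)
  rowᵥ′ : ∀ j → M′ v j ≡ P j xor δ v j
  rowᵥ′ j rewrite M′≡ v j | rowᵥ j | Pᵥ | Qᵥ =
    truthTable 3 (λ q e p → ((q xor e) xor q) xor p) (λ q e p → p xor e) tt (Q j) (δ v j) (P j)
  M≡ : ∀ i j → M i j ≡ (M′ i j xor (Q i ∧ P j)) xor (P i ∧ Q j)
  M≡ i j rewrite M′≡ i j =
    truthTable 3 (λ m a b → m) (λ m a b → (((m xor a) xor b) xor b) xor a) tt (M i j) (P i ∧ Q j) (Q i ∧ P j)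

-- Local complementation as pivoting

matrix : ∀ {n} → BGraph n → Matrix n
matrix K i j = if δ i j then not (col K i) else adj K i j

matrix-diag : ∀ {n} (K : BGraph n) i → matrix K i i ≡ not (col K i)
matrix-diag K i = cong (λ b → if b then not (col K i) else adj K i i) (δ-refl i)

matrix-off : ∀ {n} (K : BGraph n) {i j} → δ i j ≡ false → matrix K i j ≡ adj K i j
matrix-off K {i} {j} δij = cong (λ b → if b then not (col K i) else adj K i j) δij

matrix-≡ : ∀ {n} (K : BGraph n) (F : Matrix n) → (∀ i → not (col K i) ≡ F i i) →
  (∀ i j → δ i j ≡ false → adj K i j ≡ F i j) → ∀ i j → matrix K i j ≡ F i j
matrix-≡ K F diag off i j with δ-view i j
... | inj₁ refl = trans (matrix-diag K i) (diag i)
... | inj₂ δij  = trans (matrix-off K δij) (off i j δij)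

matrix-sym : ∀ {n} {K : BGraph n} → IsSimple K → Symmetric (matrix K)
matrix-sym {K = K} simple = matrix-≡ K (λ i j → matrix K j i) (λ i → sym (matrix-diag K i))
  (λ i j δij → trans (adj-sym simple i j) (sym (matrix-off K (trans (δ-sym j i) δij))))

matrix-row : ∀ {n} {K : BGraph n} → IsSimple K → ∀ w j → matrix K w j ≡ adj K w j xor (not (col K w) ∧ δ w j)
matrix-row {K = K} simple w j with δ-view w j
... | inj₁ refl = trans (matrix-diag K w) (sym (trans
  (cong₂ (λ a d → a xor (not (col K w) ∧ d)) (adj-irrefl simple w) (δ-refl w)) (Bool.∧-identityʳ (not (col K w)))))
... | inj₂ δwj  = trans (matrix-off K δwj) (sym (trans
  (cong (λ d → adj K w j xor (not (col K w) ∧ d)) δwj)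
  (trans (cong (adj K w j xor_) (Bool.∧-zeroʳ (not (col K w)))) (Bool.xor-identityʳ (adj K w j)))))

simple-· : ∀ {n} {K : BGraph n} → IsSimple K → ∀ u → IsSimple (K · u)
simple-· {K = K} simple u = record { adj-sym = symmetric ; adj-irrefl = irreflexive }
  where
  symmetric : ∀ x y → adj (K · u) x y ≡ adj (K · u) y x
  symmetric x y = cong₂ _xor_ (adj-sym simple x y)
    (cong₂ _∧_ (cong not (δ-sym x y)) (Bool.∧-comm (adj K u x) (adj K u y)))
  irreflexive : ∀ x → adj (K · u) x x ≡ false
  irreflexive x = cong₂ (λ a d → a xor (not d ∧ (adj K u x ∧ adj K u x))) (adj-irrefl simple x) (δ-refl x)

simple-⋆ : ∀ {n} {K : BGraph n} (s : List (Fin n)) → IsSimple K → IsSimple (K ⋆ s)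
simple-⋆ []      simple = simple
simple-⋆ (u ∷ s) simple = simple-⋆ s (simple-· simple u)

adj-·-off : ∀ {n} (K : BGraph n) w {x y} → δ x y ≡ false → adj (K · w) x y ≡ adj K x y xor (adj K w x ∧ adj K w y)
adj-·-off K w {x} {y} δxy = cong (λ d → adj K x y xor (not d ∧ (adj K w x ∧ adj K w y))) δxy

adj-·-self : ∀ {n} {K : BGraph n} → IsSimple K → ∀ w y → adj (K · w) w y ≡ adj K w y
adj-·-self {K = K} simple w y = trans
  (cong (λ a → adj K w y xor (not (δ w y) ∧ (a ∧ adj K w y))) (adj-irrefl simple w))
  (trans (cong (adj K w y xor_) (Bool.∧-zeroʳ (not (δ w y)))) (Bool.xor-identityʳ (adj K w y)))

adj-·-neighbour : ∀ {n} {K : BGraph n} → IsSimple K → ∀ {u v} → adj K u v ≡ true →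
  ∀ i → adj (K · u) v i ≡ (adj K v i xor δ v i) xor adj K u i
adj-·-neighbour {K = K} simple {u} {v} uv i with δ-view v i
... | inj₁ refl = trans (adj-irrefl (simple-· simple u) v)
  (sym (trans (cong₂ (λ a d → (a xor d) xor adj K u v) (adj-irrefl simple v) (δ-refl v)) (cong not uv)))
... | inj₂ δvi = trans (cong₂ (λ d e → adj K v i xor (not d ∧ (e ∧ adj K u i))) δvi uv)
  (cong (_xor adj K u i) (sym (trans (cong (adj K v i xor_) δvi) (Bool.xor-identityʳ (adj K v i)))))

adjacent-≢ : ∀ {n} {K : BGraph n} → IsSimple K → ∀ {u v} → adj K u v ≡ true → ¬ u ≡ v
adjacent-≢ simple {u} uv refl with trans (sym uv) (adj-irrefl simple u)
... | ()

col-·-white : ∀ {n} (K : BGraph n) {w} → col K w ≡ white → ∀ x → col (K · w) x ≡ col K x xor adj K w x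
col-·-white K w-white x rewrite w-white = refl

col-·-black : ∀ {n} (K : BGraph n) {w} → col K w ≡ black → ∀ x → col (K · w) x ≡ col K x
col-·-black K w-black x rewrite w-black = refl

white-pivot : ∀ {n} {K : BGraph n} → IsSimple K → ∀ {u} → col K u ≡ white →
  IsPivot (δ u) (matrix K) (matrix (K · u))
white-pivot {K = K} simple {u} u-white =
  rankOne-pivot u (adj K u) (matrix-sym simple) rowᵤ (adj-irrefl simple u) (matrix-≡ (K · u) F diag off)
  where
  F : Matrix _
  F i j = matrix K i j xor (adj K u i ∧ adj K u j)
  rowᵤ : ∀ j → matrix K u j ≡ adj K u j xor δ u j
  rowᵤ j = trans (matrix-row simple u j) (cong (λ c → adj K u j xor (not c ∧ δ u j)) u-white)
  diag : ∀ i → not (col (K · u) i) ≡ F i i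
  diag i = begin
    not (col (K · u) i)                           ≡⟨ cong not (col-·-white K u-white i) ⟩
    not (col K i xor adj K u i)                   ≡⟨ Bool.not-distribˡ-xor (col K i) (adj K u i) ⟩
    not (col K i) xor adj K u i                   ≡⟨ cong₂ _xor_ (sym (matrix-diag K i)) (sym (Bool.∧-idem (adj K u i))) ⟩
    matrix K i i xor (adj K u i ∧ adj K u i)      ∎
    where open ≡-Reasoning
  off : ∀ i j → δ i j ≡ false → adj (K · u) i j ≡ F i j
  off i j δij = trans (adj-·-off K u δij) (cong (_xor (adj K u i ∧ adj K u j)) (sym (matrix-off K δij)))

closedNbhd : ∀ {n} → BGraph n → Fin n → Vector Bool n
closedNbhd K w j = adj K w j xor δ w j

edge-complement-adj : ∀ {n} {K : BGraph n} → IsSimple K → ∀ {u v} → adj K u v ≡ true → ∀ {i j} → δ i j ≡ false →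
  adj (K ⋆ (u ∷ v ∷ u ∷ [])) i j ≡ (adj K i j xor (closedNbhd K u i ∧ closedNbhd K v j)) xor (closedNbhd K v i ∧ closedNbhd K u j)
edge-complement-adj {K = K} simple {u} {v} uv {i} {j} δij = begin
  adj (K₂ · u) i j
    ≡⟨ adj-·-off K₂ u δij ⟩
  adj K₂ i j xor (adj K₂ u i ∧ adj K₂ u j)
    ≡⟨ cong (_xor (adj K₂ u i ∧ adj K₂ u j)) (adj-·-off K₁ v δij) ⟩
  (adj K₁ i j xor (adj K₁ v i ∧ adj K₁ v j)) xor (adj K₂ u i ∧ adj K₂ u j)
    ≡⟨ cong₂ (λ p q → (adj K₁ i j xor p) xor q)
             (cong₂ _∧_ (adj-·-neighbour simple uv i) (adj-·-neighbour simple uv j))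
             (cong₂ _∧_ (K₂-uᵢ i) (K₂-uᵢ j)) ⟩
  (adj K₁ i j xor ((Q i xor a i) ∧ (Q j xor a j))) xor ((Q i xor δ u i) ∧ (Q j xor δ u j))
    ≡⟨ cong (λ p → (p xor ((Q i xor a i) ∧ (Q j xor a j))) xor ((Q i xor δ u i) ∧ (Q j xor δ u j))) (adj-·-off K u δij) ⟩
  ((adj K i j xor (a i ∧ a j)) xor ((Q i xor a i) ∧ (Q j xor a j))) xor ((Q i xor δ u i) ∧ (Q j xor δ u j))
    ≡⟨ expand (adj K i j) (a i) (a j) (Q i) (Q j) (δ u i) (δ u j) ⟩
  ((adj K i j xor (P i ∧ Q j)) xor (Q i ∧ P j)) xor (δ u i ∧ δ u j)
    ≡⟨ cong (((adj K i j xor (P i ∧ Q j)) xor (Q i ∧ P j)) xor_) (δ-∧-δ u δij) ⟩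
  ((adj K i j xor (P i ∧ Q j)) xor (Q i ∧ P j)) xor false
    ≡⟨ Bool.xor-identityʳ _ ⟩
  (adj K i j xor (P i ∧ Q j)) xor (Q i ∧ P j)
    ∎
  where
  open ≡-Reasoning
  K₁ = K · u
  K₂ = K₁ · v
  a = adj K u
  P = closedNbhd K u
  Q = closedNbhd K v
  vu₁ : adj K₁ v u ≡ true
  vu₁ = trans (adj-·-neighbour simple uv u)
    (trans (cong₂ (λ b d → (b xor d) xor adj K u u) (trans (adj-sym simple v u) uv) (δ-≢ (adjacent-≢ simple uv ∘ sym)))
           (cong not (adj-irrefl simple u)))
  K₂-uᵢ : ∀ i → adj K₂ u i ≡ Q i xor δ u i
  K₂-uᵢ i = trans (adj-·-neighbour (simple-· simple u) vu₁ i)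
    (trans (cong₂ (λ p q → (p xor δ u i) xor q) (adj-·-self simple u i) (adj-·-neighbour simple uv i))
           (truthTable 3 (λ a e q → (a xor e) xor (q xor a)) (λ a e q → q xor e) tt (a i) (δ u i) (Q i)))
  expand : Agree 7 (λ c ai aj qi qj ei ej → ((c xor (ai ∧ aj)) xor ((qi xor ai) ∧ (qj xor aj))) xor ((qi xor ei) ∧ (qj xor ej)))
                   (λ c ai aj qi qj ei ej → ((c xor ((ai xor ei) ∧ qj)) xor (qi ∧ (aj xor ej))) xor (ei ∧ ej))
  expand = truthTable 7 _ _ tt

edge-pivot : ∀ {n} {K : BGraph n} → IsSimple K → ∀ {u v} → adj K u v ≡ true → col K u ≡ black → col K v ≡ black →
  IsPivot (δ u ∪ δ v) (matrix K) (matrix (K ⋆ (u ∷ v ∷ u ∷ [])))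
edge-pivot {K = K} simple {u} {v} uv u-black v-black =
  rankTwo-pivot P Q (matrix-sym simple) u≢v (row u-black) (row v-black) Pᵤ Pᵥ Qᵤ Qᵥ (matrix-≡ K₃ F diag off)
  where
  K₁ = K · u
  K₂ = K₁ · v
  K₃ = K₂ · u
  P = closedNbhd K u
  Q = closedNbhd K v
  u≢v : ¬ u ≡ v
  u≢v = adjacent-≢ simple uv
  row : ∀ {w} → col K w ≡ black → ∀ j → matrix K w j ≡ closedNbhd K w j xor δ w j
  row {w} w-black j = trans (matrix-row simple w j)
    (trans (cong (λ c → adj K w j xor (not c ∧ δ w j)) w-black)
           (truthTable 2 (λ a e → a xor false) (λ a e → (a xor e) xor e) tt (adj K w j) (δ w j)))
  Pᵤ : P u ≡ true
  Pᵤ = cong₂ _xor_ (adj-irrefl simple u) (δ-refl u)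
  Pᵥ : P v ≡ true
  Pᵥ = cong₂ _xor_ uv (δ-≢ u≢v)
  Qᵤ : Q u ≡ true
  Qᵤ = cong₂ _xor_ (trans (adj-sym simple v u) uv) (δ-≢ (u≢v ∘ sym))
  Qᵥ : Q v ≡ true
  Qᵥ = cong₂ _xor_ (adj-irrefl simple v) (δ-refl v)
  v-black₁ : col K₁ v ≡ black
  v-black₁ = trans (col-·-black K u-black v) v-black
  u-black₂ : col K₂ u ≡ black
  u-black₂ = trans (col-·-black K₁ v-black₁ u) (trans (col-·-black K u-black u) u-black)
  col₃ : ∀ i → col K₃ i ≡ col K i
  col₃ i = trans (col-·-black K₂ u-black₂ i) (trans (col-·-black K₁ v-black₁ i) (col-·-black K u-black i))
  F : Matrix _
  F i j = (matrix K i j xor (P i ∧ Q j)) xor (Q i ∧ P j)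
  diag : ∀ i → not (col K₃ i) ≡ F i i
  diag i = trans (cong not (col₃ i)) (trans (sym (matrix-diag K i))
    (truthTable 3 (λ m p q → m) (λ m p q → (m xor (p ∧ q)) xor (q ∧ p)) tt (matrix K i i) (P i) (Q i)))
  off : ∀ i j → δ i j ≡ false → adj K₃ i j ≡ F i j
  off i j δij = trans (edge-complement-adj simple uv δij)
    (cong (λ m → (m xor (P i ∧ Q j)) xor (Q i ∧ P j)) (sym (matrix-off K δij)))

-- Reduced parity words

⋆-++ : ∀ {n} (K : BGraph n) s t → K ⋆ (s ++ t) ≡ (K ⋆ s) ⋆ t
⋆-++ K = foldl-++ _·_ K

white-pair-blackens : ∀ {n} {K : BGraph n} → IsSimple K → ∀ {u v} → adj K u v ≡ true →
  col K u ≡ white → col (K · u) v ≡ white → col ((K · u) · v) u ≡ black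
white-pair-blackens {K = K} simple {u} {v} uv u-white v-white₁ = begin
  col ((K · u) · v) u                  ≡⟨ col-·-white (K · u) v-white₁ u ⟩
  col (K · u) u xor adj (K · u) v u    ≡⟨ cong₂ _xor_ u-white₁ vu₁ ⟩
  true                                 ∎
  where
  open ≡-Reasoning
  u-white₁ : col (K · u) u ≡ false
  u-white₁ = trans (col-·-white K u-white u) (cong₂ _xor_ u-white (adj-irrefl simple u))
  vu₁ : adj (K · u) v u ≡ true
  vu₁ = trans (adj-sym (simple-· simple u) v u) (trans (adj-·-self simple u v) uv)

letters : ∀ {n} → List (Fin n) → Vector Bool n
letters []      i = false
letters (u ∷ s) i = δ u i ∨ letters s i

letters-++ : ∀ {n} (s t : List (Fin n)) → letters (s ++ t) ≗ letters s ∪ letters t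
letters-++ []      t i = refl
letters-++ (u ∷ s) t i = trans (cong (δ u i ∨_) (letters-++ s t i)) (sym (Bool.∨-assoc (δ u i) (letters s i) (letters t i)))

letters-∈ : ∀ {n} {s : List (Fin n)} {u} → u ∈ s → letters s u ≡ true
letters-∈ {s = u ∷ s} (here refl) = cong (_∨ letters s u) (δ-refl u)
letters-∈ {s = w ∷ s} (there u∈s) = trans (cong (δ w _ ∨_) (letters-∈ u∈s)) (Bool.∨-zeroʳ (δ w _))

letters-∉ : ∀ {n} {s : List (Fin n)} {u} → u ∉ s → letters s u ≡ false
letters-∉ {s = []}    u∉s = refl
letters-∉ {s = w ∷ s} u∉s = cong₂ _∨_ (δ-≢ (u∉s ∘ here ∘ sym)) (letters-∉ (u∉s ∘ there))

letters-disjoint : ∀ {n} {s : List (Fin n)} {u} → u ∉ s → Disjoint (letters s) (δ u)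
letters-disjoint {s = s} {u} u∉s i with δ-view u i
... | inj₁ refl = cong (_∧ δ u u) (letters-∉ u∉s)
... | inj₂ δui  = trans (cong (letters s i ∧_) δui) (Bool.∧-zeroʳ (letters s i))

disjoint-∪ : ∀ {n} {S R R′ : Vector Bool n} → Disjoint S R → Disjoint S R′ → Disjoint S (R ∪ R′)
disjoint-∪ {S = S} {R} {R′} SR SR′ i =
  trans (Bool.∧-distribˡ-∨ (S i) (R i) (R′ i)) (cong₂ _∨_ (SR i) (SR′ i))

triple-∷ʳ : ∀ {A : Set} (s′ s : List A) {a b u} → s′ ++ (a ∷ b ∷ a ∷ []) ≡ s ++ [ u ] → u ∈ s
triple-∷ʳ s′ s {a} {b} eq with ∷ʳ-injective (s′ ++ a ∷ b ∷ []) s (trans (++-assoc s′ (a ∷ b ∷ []) [ a ]) eq)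
... | s′ab≡s , refl = subst (a ∈_) s′ab≡s (∈-++⁺ʳ s′ (here refl))

triple-injective : ∀ {A : Set} (s′ s : List A) {a b c a′ b′ c′} →
  s′ ++ (a ∷ b ∷ c ∷ []) ≡ s ++ (a′ ∷ b′ ∷ c′ ∷ []) → s′ ≡ s × a ≡ a′ × b ≡ b′ × c ≡ c′
triple-injective s′ s {a} {b} {c} {a′} {b′} {c′} eq
  with ∷ʳ-injective (s′ ++ a ∷ b ∷ []) (s ++ a′ ∷ b′ ∷ [])
         (trans (++-assoc s′ (a ∷ b ∷ []) [ c ]) (trans eq (sym (++-assoc s (a′ ∷ b′ ∷ []) [ c′ ]))))
... | eq₂ , refl with ∷ʳ-injective (s′ ++ [ a ]) (s ++ [ a′ ])
                        (trans (++-assoc s′ [ a ] [ b ]) (trans eq₂ (sym (++-assoc s [ a′ ] [ b′ ]))))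
... | eq₁ , refl with ∷ʳ-injective s′ s eq₁
... | refl , refl = refl , refl , refl , refl

-- A parity word may have several derivations; for a reduced word the last block pins down the last rule used.
parity-∷ʳ⁻ : ∀ {n} {G : BGraph n} {w s u} → Parity G w → w ≡ s ++ [ u ] → u ∉ s →
  Parity G s × col (G ⋆ s) u ≡ white
parity-∷ʳ⁻ {s = []}    p-nil ()
parity-∷ʳ⁻ {s = _ ∷ _} p-nil ()
parity-∷ʳ⁻ {s = s} (p-white {s′} p u-white) eq u∉s with ∷ʳ-injective s′ s eq
... | refl , refl = p , u-white
parity-∷ʳ⁻ {s = s} (p-uvu {s′} _ _ _ _) eq u∉s = ⊥-elim (u∉s (triple-∷ʳ s′ s eq))
parity-∷ʳ⁻ {s = s} (p-vuv {s′} _ _ _ _) eq u∉s = ⊥-elim (u∉s (triple-∷ʳ s′ s eq))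

parity-triple⁻ : ∀ {n} {G : BGraph n} → IsSimple G → ∀ {w s u v} → Parity G w → w ≡ s ++ (u ∷ v ∷ u ∷ []) →
  u ∉ s → v ∉ s → adj (G ⋆ s) u v ≡ true → Parity G s × col (G ⋆ s) u ≡ black × col (G ⋆ s) v ≡ black
parity-triple⁻ simple {s = []}    p-nil ()
parity-triple⁻ simple {s = _ ∷ _} p-nil ()
-- Three white steps u, v, u are impossible: after the first two, u is black.
parity-triple⁻ {G = G} simple {s = s} {u} {v} (p-white {s′} p u-white₂) eq u∉s v∉s uv
  with ∷ʳ-injective s′ (s ++ u ∷ v ∷ []) (trans eq (sym (++-assoc s (u ∷ v ∷ []) [ u ])))
... | refl , refl with parity-∷ʳ⁻ p (sym (++-assoc s [ u ] [ v ])) v∉s∷ʳu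
  where
  v∉s∷ʳu : v ∉ s ++ [ u ]
  v∉s∷ʳu v∈ with ∈-++⁻ s v∈
  ... | inj₁ v∈s       = v∉s v∈s
  ... | inj₂ (here v≡u) = adjacent-≢ (simple-⋆ s simple) uv (sym v≡u)
... | p₁ , v-white₁ with parity-∷ʳ⁻ p₁ refl u∉s
... | _ , u-white with trans (sym (white-pair-blackens (simple-⋆ s simple) uv u-white v-white₁′)) u-white₂′
  where
  v-white₁′ : col ((G ⋆ s) · u) v ≡ white
  v-white₁′ = subst (λ H → col H v ≡ white) (⋆-++ G s [ u ]) v-white₁
  u-white₂′ : col (((G ⋆ s) · u) · v) u ≡ white
  u-white₂′ = subst (λ H → col H u ≡ white) (⋆-++ G s (u ∷ v ∷ [])) u-white₂
... | ()
parity-triple⁻ simple {s = s} (p-uvu {s′} p _ u-black v-black) eq _ _ _ with triple-injective s′ s eq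
... | refl , refl , refl , refl = p , u-black , v-black
parity-triple⁻ simple {s = s} (p-vuv {s′} p _ v-black u-black) eq _ _ _ with triple-injective s′ s eq
... | refl , refl , refl , refl = p , u-black , v-black

pivot-word : ∀ {n} {G : BGraph n} → IsSimple G → ∀ {s} → Reduced G s → Parity G s →
  IsPivot (letters s) (matrix G) (matrix (G ⋆ s))
pivot-word simple r-nil _ = (λ x i → refl) , (λ x i → refl)
pivot-word {G = G} simple (r-single {s} {u} r u∉s) p with parity-∷ʳ⁻ p refl u∉s
... | p′ , u-white rewrite ⋆-++ G s [ u ] =
  pivot-cong letters≗
    (pivot-∪ (letters-disjoint u∉s) (pivot-word simple r p′) (white-pivot (simple-⋆ s simple) u-white))
  where
  letters≗ : letters s ∪ δ u ≗ letters (s ++ [ u ])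
  letters≗ i = trans (cong (letters s i ∨_) (sym (Bool.∨-identityʳ (δ u i)))) (sym (letters-++ s [ u ] i))
pivot-word {G = G} simple (r-triple {s} {u} {v} r u∉s v∉s uv) p with parity-triple⁻ simple p refl u∉s v∉s uv
... | p′ , u-black , v-black rewrite ⋆-++ G s (u ∷ v ∷ u ∷ []) =
  pivot-cong letters≗
    (pivot-∪ (disjoint-∪ {S = letters s} {δ u} {δ v} (letters-disjoint u∉s) (letters-disjoint v∉s)) (pivot-word simple r p′)
             (edge-pivot (simple-⋆ s simple) uv u-black v-black))
  where
  letters≗ : letters s ∪ (δ u ∪ δ v) ≗ letters (s ++ (u ∷ v ∷ u ∷ []))
  letters≗ i = trans (cong (letters s i ∨_) (truthTable 2 (λ a b → a ∨ b) (λ a b → a ∨ (b ∨ (a ∨ false))) tt (δ u i) (δ v i)))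
                     (sym (letters-++ s (u ∷ v ∷ u ∷ []) i))

-- Automorphisms

full : ∀ {n} → Vector Bool n
full _ = true

module _ {n} (σ : Permutation′ n) where

  π : Fin n → Fin n
  π = σ ⟨$⟩ʳ_

  Invariant : Matrix n → Set
  Invariant M = ∀ i j → M (π i) (π j) ≡ M i j

  Commutes : Matrix n → Set
  Commutes M = ∀ x → M *ᵥ (x ∘ π) ≗ (M *ᵥ x) ∘ π

  δ-permute : ∀ i j → δ (π i) (π j) ≡ δ i j
  δ-permute i j with i ≟ j
  ... | yes refl = δ-refl (π i)
  ... | no i≢j   = δ-≢ (λ πi≡πj → i≢j (trans (sym (inverseˡ σ)) (trans (cong (σ ⟨$⟩ˡ_) πi≡πj) (inverseˡ σ))))

  invariant⇒commutes : ∀ M → Invariant M → Commutes M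
  invariant⇒commutes M inv x i = sym (begin
    sum (λ j → M (π i) j ∧ x j)           ≡⟨ sum-permute (λ j → M (π i) j ∧ x j) σ ⟩
    sum (λ k → M (π i) (π k) ∧ x (π k))   ≡⟨ sum-cong-≗ (λ k → cong (_∧ x (π k)) (inv i k)) ⟩
    sum (λ k → M i k ∧ x (π k))           ∎)
    where open ≡-Reasoning

  commutes⇒invariant : ∀ M → Commutes M → Invariant M
  commutes⇒invariant M comm i j = begin
    M (π i) (π j)                ≡⟨ sym (dot-δ (M (π i)) (π j)) ⟩
    (M *ᵥ δ (π j)) (π i)         ≡⟨ sym (comm (δ (π j)) i) ⟩
    (M *ᵥ (δ (π j) ∘ π)) i       ≡⟨ dot-congʳ (M i) (δ-permute j) ⟩
    (M *ᵥ δ j) i                 ≡⟨ dot-δ (M i) j ⟩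
    M i j                        ∎
    where open ≡-Reasoning

  inverse-commutes : ∀ A B → (∀ x → B *ᵥ (A *ᵥ x) ≗ x) → (∀ x → A *ᵥ (B *ᵥ x) ≗ x) → Commutes A → Commutes B
  inverse-commutes A B BA AB comm x i = begin
    (B *ᵥ (x ∘ π)) i                 ≡⟨ dot-congʳ (B i) (λ k → sym (AB x (π k))) ⟩
    (B *ᵥ ((A *ᵥ (B *ᵥ x)) ∘ π)) i   ≡⟨ dot-congʳ (B i) (λ k → sym (comm (B *ᵥ x) k)) ⟩
    (B *ᵥ (A *ᵥ ((B *ᵥ x) ∘ π))) i   ≡⟨ BA ((B *ᵥ x) ∘ π) i ⟩
    (B *ᵥ x) (π i)                   ∎
    where open ≡-Reasoning

  -- override full x y = y, so IsPivot full A B says that A and B are mutually inverse.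
  invariant-inverse⇔ : ∀ {A B} → IsPivot full A B → Invariant A ⇔ Invariant B
  invariant-inverse⇔ {A} {B} (AB , BA) = mk⇔
    (commutes⇒invariant B ∘ inverse-commutes A B AB BA ∘ invariant⇒commutes A)
    (commutes⇒invariant A ∘ inverse-commutes B A BA AB ∘ invariant⇒commutes B)

  isAut⇔invariant : ∀ {K : BGraph n} → IsSimple K → IsAut K σ ⇔ Invariant (matrix K)
  isAut⇔invariant {K} simple = mk⇔ to from
    where
    to : IsAut K σ → Invariant (matrix K)
    to (adj-pres , col-pres) i j =
      trans (cong (λ b → if b then not (col K (π i)) else adj K (π i) (π j)) (δ-permute i j))
            (cong₂ (λ c a → if δ i j then not c else a) (col-pres i) (adj-pres i j))
    from : Invariant (matrix K) → IsAut K σ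
    from inv = adj-pres , col-pres
      where
      adj-pres : ∀ i j → adj K (π i) (π j) ≡ adj K i j
      adj-pres i j with δ-view i j
      ... | inj₁ refl = trans (adj-irrefl simple (π i)) (sym (adj-irrefl simple i))
      ... | inj₂ δij  = trans (sym (matrix-off K (trans (δ-permute i j) δij))) (trans (inv i j) (matrix-off K δij))
      col-pres : ∀ i → col K (π i) ≡ col K i
      col-pres i = Bool.not-injective (trans (sym (matrix-diag K (π i))) (trans (inv i i) (matrix-diag K i)))

corollary1p7p3 : (n : ℕ) (G : BGraph n) → IsSimple G →
    (s : List (Fin n)) → Parity G s → Reduced G s → CoversAll s →
    (σ : Permutation′ n) → IsAut (G ⋆ s) σ ⇔ IsAut G σ
corollary1p7p3 n G simple s parity reduced covers σ =
  ⇔-sym (isAut⇔invariant σ simple) ⇔-∘ (invariant-inverse⇔ σ G⁻¹ ⇔-∘ isAut⇔invariant σ (simple-⋆ s simple))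
  where
  G⁻¹ : IsPivot full (matrix (G ⋆ s)) (matrix G)
  G⁻¹ = swap (pivot-cong (λ i → letters-∈ (covers i)) (pivot-word simple reduced parity))
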